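{- For every positive integer $r$, $S_\times(r)\ge 2^{S_+(r)-1}$. In particular, $S_\times(r)\ge 2^{2^r}$.
   Context: For a positive integer $r$, $S_+(r)$ is the smallest integer such that every coloring of $\{1,\dots,S_+(r)\}$ with $r$ colors contains a monochromatic set $\{a,b,a+b\}$ (with $a,b$ positive integers, possibly equal), and $S_\times(r)$ is the smallest integer such that every coloring of $\{2,\dots,S_\times(r)\}$ with $r$ colors contains a monochromatic set $\{x,y,xy\}$ (with $x,y\ge 2$ integers, possibly equal). -}

module Defs where

open import Data.Nat using (ℕ; _+_; _*_; _≤_)
open import Data.Fin using (Fin)
open import Data.Product using (Σ; _×_; ∃-syntax)
open import Relation.Binary.PropositionalEquality using (_≡_)

-- An r-colouring; only its values on the relevant interval matter.
Colouring : ℕ → Set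
Colouring r = ℕ → Fin r

MonoSum : (r n : ℕ) → Colouring r → Set
MonoSum r n c = ∃[ a ] ∃[ b ] (1 ≤ a × 1 ≤ b × a + b ≤ n × c a ≡ c b × c b ≡ c (a + b))

MonoProd : (r n : ℕ) → Colouring r → Set
MonoProd r n c = ∃[ x ] ∃[ y ] (2 ≤ x × 2 ≤ y × x * y ≤ n × c x ≡ c y × c y ≡ c (x * y))

SumProperty : ℕ → ℕ → Set
SumProperty r n = (c : Colouring r) → MonoSum r n c

ProdProperty : ℕ → ℕ → Set
ProdProperty r n = (c : Colouring r) → MonoProd r n c

IsSPlus : ℕ → ℕ → Set
IsSPlus r s = SumProperty r s × ((k : ℕ) → SumProperty r k → s ≤ k)

IsSTimes : ℕ → ℕ → Set
IsSTimes r m = ProdProperty r m × ((k : ℕ) → ProdProperty r k → m ≤ k)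

-- Lower bound 2^(s-1): colour x ≥ 2 by the colour of Ω(x), its number of prime factors
-- counted with multiplicity.  Since Ω(xy) = Ω(x) + Ω(y), a monochromatic product triple
-- in {2,…,m} yields a monochromatic Schur triple in {1,…,Ω(xy)}, and 2^Ω(xy) ≤ xy ≤ m;
-- so m < 2^(s-1) would give the Schur property for s - 1, contradicting minimality of s.
-- Lower bound 2^2^r: colour x by the largest j < r with 2^2^j ≤ x.  Two numbers of level j
-- have product at least (2^2^j)² = 2^2^(j+1), hence a product of higher level, or beyond
-- the interval when j = r - 1.
module Submission where

open import Defs
open import Data.Nat using (ℕ; _≤_; _^_; _∸_)
open import Data.Product using (_×_)

open import Data.Nat using (zero; suc; _+_; _*_; _<_; z≤n; s≤s; s≤s⁻¹; _≤?_; NonZero; nonTrivial⇒n>1)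
open import Data.Nat.Properties
open import Data.Nat.ListAction using (product)
open import Data.Nat.ListAction.Properties using (product-++)
open import Data.Nat.Primality using (Prime; prime)
open import Data.Nat.Primality.Factorisation using (PrimeFactorisation; factorise; factorisationUnique)
open import Data.Fin using (fromℕ<) renaming (zero to fzero)
open import Data.Fin.Properties using (fromℕ<-injective)
open import Data.Product using (_,_)
open import Data.List using ([]; _∷_; _++_; length)
open import Data.List.Properties using (length-++)
open import Data.List.Relation.Unary.All using (All; []; _∷_)
open import Data.List.Relation.Unary.All.Properties using (++⁺)
open import Data.List.Relation.Binary.Permutation.Propositional.Properties using (↭-length)
open import Data.Sum using (inj₁; inj₂)
open import Relation.Binary.PropositionalEquality
open import Relation.Nullary using (¬_; yes; no; contradiction)
open import Function using (_∘_)

open PrimeFactorisation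

Ω : ℕ → ℕ
Ω zero      = 0
Ω n@(suc _) = length (factors (factorise n))

Ω-length : ∀ {n} .{{_ : NonZero n}} (f : PrimeFactorisation n) → Ω n ≡ length (factors f)
Ω-length {suc n} f = ↭-length (factorisationUnique (factorise (suc n)) f)

_*ᶠ_ : ∀ {m n} → PrimeFactorisation m → PrimeFactorisation n → PrimeFactorisation (m * n)
f *ᶠ g = record
  { factors         = factors f ++ factors g
  ; isFactorisation = trans (cong₂ _*_ (isFactorisation f) (isFactorisation g))
                            (sym (product-++ (factors f) (factors g)))
  ; factorsPrime    = ++⁺ (factorsPrime f) (factorsPrime g)
  }

Ω-* : ∀ m n .{{_ : NonZero m}} .{{_ : NonZero n}} → Ω (m * n) ≡ Ω m + Ω n
Ω-* m@(suc _) n@(suc _) = begin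
  Ω (m * n)                                               ≡⟨ Ω-length (factorise m *ᶠ factorise n) ⟩
  length (factors (factorise m) ++ factors (factorise n)) ≡⟨ length-++ (factors (factorise m)) ⟩
  Ω m + Ω n                                               ∎
  where open ≡-Reasoning

prime⇒2≤ : ∀ {p} → Prime p → 2 ≤ p
prime⇒2≤ {p} (prime {{p>1}} _) = nonTrivial⇒n>1 p {{p>1}}

2^length≤product : ∀ {ps} → All Prime ps → 2 ^ length ps ≤ product ps
2^length≤product []       = ≤-refl
2^length≤product (p ∷ ps) = *-mono-≤ (prime⇒2≤ p) (2^length≤product ps)

2^Ω≤ : ∀ n .{{_ : NonZero n}} → 2 ^ Ω n ≤ n
2^Ω≤ n@(suc _) = subst (2 ^ Ω n ≤_) (sym (isFactorisation f)) (2^length≤product (factorsPrime f))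
  where f = factorise n

Ω-positive : ∀ {n} → 2 ≤ n → 1 ≤ Ω n
Ω-positive {n@(suc _)} 2≤n with factors (factorise n) | isFactorisation (factorise n)
... | []    | n≡1 = contradiction (≤-trans 2≤n (≤-reflexive n≡1)) λ { (s≤s ()) }
... | _ ∷ _ | _   = s≤s z≤n

2^m<2^n⇒m<n : ∀ {m n} → 2 ^ m < 2 ^ n → m < n
2^m<2^n⇒m<n {m} {n} 2^m<2^n = ≰⇒> λ n≤m → <⇒≱ 2^m<2^n (^-monoʳ-≤ 2 n≤m)

prodProperty⇒sumProperty : ∀ {r m k} → ProdProperty r m → m < 2 ^ k → SumProperty r k
prodProperty⇒sumProperty {r} {m} {k} prod m<2^k c = schurTriple (prod (λ x → c (Ω x)))
  where
  schurTriple : MonoProd r m (λ x → c (Ω x)) → MonoSum r k c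
  schurTriple (x@(suc _) , y@(suc _) , 2≤x , 2≤y , xy≤m , cx≡cy , cy≡cxy) =
    Ω x , Ω y , Ω-positive 2≤x , Ω-positive 2≤y , <⇒≤ Ωx+Ωy<k ,
    cx≡cy , trans cy≡cxy (cong c (Ω-* x y))
    where
    Ωx+Ωy<k : Ω x + Ω y < k
    Ωx+Ωy<k = 2^m<2^n⇒m<n (begin-strict
      2 ^ (Ω x + Ω y) ≡⟨ cong (2 ^_) (Ω-* x y) ⟨
      2 ^ Ω (x * y)   ≤⟨ 2^Ω≤ (x * y) ⟩
      x * y           ≤⟨ xy≤m ⟩
      m               <⟨ m<2^k ⟩
      2 ^ k           ∎)
      where open ≤-Reasoning

¬sumProperty[0] : ∀ {r} → ¬ SumProperty (suc r) 0
¬sumProperty[0] sum with sum (λ _ → fzero)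
... | suc _ , _ , _ , _ , () , _

2^pred≤STimes : ∀ {r s m} → IsSPlus (suc r) s → IsSTimes (suc r) m → 2 ^ (s ∸ 1) ≤ m
2^pred≤STimes {s = zero}  (sum , _) _ = contradiction sum ¬sumProperty[0]
2^pred≤STimes {s = suc s} {m} (_ , minimal) (prod , _) with 2 ^ s ≤? m
... | yes 2^s≤m = 2^s≤m
... | no  2^s≰m = contradiction (minimal s (prodProperty⇒sumProperty prod (≰⇒> 2^s≰m))) (n≮n s)

doubleExp : ℕ → ℕ
doubleExp j = 2 ^ 2 ^ j

doubleExp-suc : ∀ j → doubleExp (suc j) ≡ doubleExp j * doubleExp j
doubleExp-suc j = trans (cong (λ e → 2 ^ (2 ^ j + e)) (+-identityʳ (2 ^ j)))
                        (^-distribˡ-+-* 2 (2 ^ j) (2 ^ j))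

level : ℕ → ℕ → ℕ
level zero    x = 0
level (suc n) x with doubleExp (suc n) ≤? x
... | yes _ = suc n
... | no  _ = level n x

level≤ : ∀ n x → level n x ≤ n
level≤ zero    x = z≤n
level≤ (suc n) x with doubleExp (suc n) ≤? x
... | yes _ = ≤-refl
... | no  _ = m≤n⇒m≤1+n (level≤ n x)

doubleExp-level≤ : ∀ n {x} → 2 ≤ x → doubleExp (level n x) ≤ x
doubleExp-level≤ zero    2≤x = 2≤x
doubleExp-level≤ (suc n) {x} 2≤x with doubleExp (suc n) ≤? x
... | yes ≤x = ≤x
... | no  _  = doubleExp-level≤ n 2≤x

level-maximal : ∀ {n x j} → j ≤ n → doubleExp j ≤ x → j ≤ level n x
level-maximal {j = zero}  _ _ = z≤n
level-maximal {suc n} {x} {suc j} j≤n ≤x with doubleExp (suc n) ≤? x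
... | yes _ = j≤n
... | no  ≰x with m≤n⇒m<n∨m≡n j≤n
...   | inj₁ j<n  = level-maximal (s≤s⁻¹ j<n) ≤x
...   | inj₂ refl = contradiction ≤x ≰x

doubleExp-suc-level≤* : ∀ n {x y} → 2 ≤ x → 2 ≤ y → level n x ≡ level n y →
                        doubleExp (suc (level n x)) ≤ x * y
doubleExp-suc-level≤* n {x} {y} 2≤x 2≤y same = begin
  doubleExp (suc (level n x))                   ≡⟨ doubleExp-suc (level n x) ⟩
  doubleExp (level n x) * doubleExp (level n x) ≡⟨ cong (λ j → doubleExp (level n x) * doubleExp j) same ⟩
  doubleExp (level n x) * doubleExp (level n y) ≤⟨ *-mono-≤ (doubleExp-level≤ n 2≤x) (doubleExp-level≤ n 2≤y) ⟩
  x * y                                         ∎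
  where open ≤-Reasoning

levelColouring : ∀ r → Colouring (suc r)
levelColouring r x = fromℕ< (s≤s (level≤ r x))

levelColouring≡⇒level≡ : ∀ r {x y} → levelColouring r x ≡ levelColouring r y → level r x ≡ level r y
levelColouring≡⇒level≡ r {x} {y} = fromℕ<-injective (level r x) (level r y) (s≤s (level≤ r x)) (s≤s (level≤ r y))

¬monoProd[levelColouring] : ∀ r {m} → m < doubleExp (suc r) → ¬ MonoProd (suc r) m (levelColouring r)
¬monoProd[levelColouring] r {m} m<bound (x , y , 2≤x , 2≤y , xy≤m , cx≡cy , cy≡cxy)
  with m≤n⇒m<n∨m≡n (level≤ r x)
... | inj₁ k<r = n≮n k (<-≤-trans (level-maximal k<r bound≤xy) (≤-reflexive (sym k≡level[xy])))
  where
  k = level r x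
  bound≤xy : doubleExp (suc k) ≤ x * y
  bound≤xy = doubleExp-suc-level≤* r 2≤x 2≤y (levelColouring≡⇒level≡ r cx≡cy)
  k≡level[xy] : k ≡ level r (x * y)
  k≡level[xy] = trans (levelColouring≡⇒level≡ r cx≡cy) (levelColouring≡⇒level≡ r cy≡cxy)
... | inj₂ k≡r = <⇒≱ m<bound (begin
  doubleExp (suc r)           ≡⟨ cong (doubleExp ∘ suc) k≡r ⟨
  doubleExp (suc (level r x)) ≤⟨ doubleExp-suc-level≤* r 2≤x 2≤y (levelColouring≡⇒level≡ r cx≡cy) ⟩
  x * y                       ≤⟨ xy≤m ⟩
  m                           ∎)
  where open ≤-Reasoning

doubleExp≤STimes : ∀ {r m} → IsSTimes (suc r) m → doubleExp (suc r) ≤ m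
doubleExp≤STimes {r} {m} (prod , _) with doubleExp (suc r) ≤? m
... | yes bound≤m = bound≤m
... | no  bound≰m = contradiction (prod (levelColouring r)) (¬monoProd[levelColouring] r (≰⇒> bound≰m))

lemma4 : (r : ℕ) → 1 ≤ r → (s m : ℕ) → IsSPlus r s → IsSTimes r m →
         (2 ^ (s ∸ 1) ≤ m) × (2 ^ (2 ^ r) ≤ m)
lemma4 (suc r) _ s m sPlus sTimes = 2^pred≤STimes sPlus sTimes , doubleExp≤STimes sTimes
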